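{- Let $n,k\in\mathbb{N}$. If a real number $\alpha>0$ is an infinite loop mod $n$, then $\alpha$ is an infinite loop mod $kn$.
   Context: For $\alpha>0$ with continued fraction expansion $[a_0;a_1,a_2,\ldots]$, the convergent denominators are $q_{ -1}=0$, $q_0=1$, $q_k=a_kq_{k-1}+q_{k-2}$, and the semi-convergent denominators are $q_{\{k,m\}}=mq_k+q_{k-1}$ for $k\ge0$ and integers $0\le m\le a_{k+1}$ (if $\alpha$ is rational with finite expansion $[a_0;\ldots,a_N]$, one regards $a_{N+1}=\infty$). A real number $\alpha>0$ is an infinite loop mod $n$ if none of its semi-convergent denominators is divisible by $n$, apart from $q_{ -1}=0$. -}

module Defs where

open import Data.Nat using (ℕ; zero; suc; _+_; _*_; _≤_; _<_)
open import Data.Nat.Divisibility using (_∣_)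
open import Data.Product using (∃₂; _×_)
open import Data.Sum using (_⊎_)
open import Relation.Binary.PropositionalEquality using (_≡_)
open import Relation.Nullary using (¬_)

-- A positive real number α is represented by its (regular) continued
-- fraction expansion [a₀; a₁, a₂, …] with a₀ ≥ 0 and aᵢ ≥ 1 for i ≥ 1.
-- Irrational α: infinite expansion.  Rational α: finite expansion
-- [a₀; …, a_N] (only a₀ … a_N are meaningful; a_{N+1} = ∞ by convention).
-- Positivity α > 0 is a₀ > 0 or N > 0 (automatic in the infinite case).
data ContFrac : Set where
  infiniteCF : (a : ℕ → ℕ) → (∀ i → 1 ≤ a (suc i)) → ContFrac
  finiteCF   : (N : ℕ) (a : ℕ → ℕ) → (∀ i → i < N → 1 ≤ a (suc i)) →
               (0 < a 0 ⊎ 0 < N) → ContFrac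

pq : ContFrac → ℕ → ℕ
pq (infiniteCF a _)    = a
pq (finiteCF _ a _ _)  = a

-- Shifted convergent denominators: Q j = q_{j-1}, i.e.
-- Q 0 = q_{-1} = 0, Q 1 = q_0 = 1, q_k = a_k q_{k-1} + q_{k-2}.
Q : (ℕ → ℕ) → ℕ → ℕ
Q a zero                = 0
Q a (suc zero)          = 1
Q a (suc (suc j))       = a (suc j) * Q a (suc j) + Q a j

qd : ContFrac → ℕ → ℕ
qd α k = Q (pq α) (suc k)

qprev : ContFrac → ℕ → ℕ
qprev α k = Q (pq α) k

-- admissible index pairs (k, m) of semi-convergents: k ≥ 0, 0 ≤ m ≤ a_{k+1},
-- where for a finite expansion k ≤ N and a_{N+1} = ∞ (no bound on m).
Admissible : ContFrac → ℕ → ℕ → Set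
Admissible (infiniteCF a _)   k m = m ≤ a (suc k)
Admissible (finiteCF N a _ _) k m = (k < N × m ≤ a (suc k)) ⊎ k ≡ N

semiConv : ContFrac → ℕ → ℕ → ℕ
semiConv α k m = m * qd α k + qprev α k

-- α is an infinite loop mod n: no semi-convergent denominator q_{k,m}
-- is divisible by n, apart from q_{0,0} = q_{-1} = 0.
InfiniteLoop : ℕ → ContFrac → Set
InfiniteLoop n α = ∀ k m → Admissible α k m → ¬ (k ≡ 0 × m ≡ 0) →
                   ¬ (n ∣ semiConv α k m)

{-# OPTIONS --safe #-}
module Submission where

open import Defs
open import Data.Nat using (ℕ; _*_)
open import Data.Nat.Divisibility using (_∣_; ∣-trans; n∣m*n)

infiniteLoop-multiple : ∀ {n n′} α → n ∣ n′ → InfiniteLoop n α → InfiniteLoop n′ α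
infiniteLoop-multiple α n∣n′ loop k m adm nonzero n′∣q = loop k m adm nonzero (∣-trans n∣n′ n′∣q)

mainTheorem8 : (n k : ℕ) (α : ContFrac) →
    InfiniteLoop n α → InfiniteLoop (k * n) α
mainTheorem8 n k α = infiniteLoop-multiple α (n∣m*n k)
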